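{- $R_{C_4}(3,4,3,4)=R(2,3,2,3)+1$; that is, $R_{C_4}(3,4,3,4)=7$.
   Context: $C_4\le S_4$ denotes the cyclic group generated by $(1\,2\,3\,4)$. A $4$-edge-coloured complete graph is a complete graph with each edge coloured from $\{1,2,3,4\}$. For $\pi\in C_4$ and a vertex $v$, switching at $v$ with $\pi$ recolours every edge incident with $v$ of colour $i$ to colour $\pi(i)$, leaving other edges unchanged. Two such graphs on the same vertex set are $C_4$-switch equivalent if one is obtained from the other by a finite sequence of switches. $K_t^{(i)}$ is a complete graph on $t$ vertices with all edges of colour $i$. $R_{C_4}(a_1,a_2,a_3,a_4)$ is the least $n$ such that every $4$-edge-coloured complete graph on $n$ vertices is $C_4$-switch equivalent to one containing, for some $i$, a copy of $K_{a_i}^{(i)}$. $R(2,3,2,3)$ is the classical $4$-colour Ramsey number (which equals $R(3,3)=6$). -}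

module Defs where

open import Data.Nat using (ℕ; _<_)
open import Data.Fin using (Fin; _≟_)
open import Data.Fin.Patterns using (0F; 1F; 2F; 3F)
open import Data.Product using (Σ; ∃; _×_)
open import Data.Sum using (_⊎_)
open import Relation.Nullary using (¬_; yes; no)
open import Relation.Binary.PropositionalEquality using (_≡_; _≢_)
open import Relation.Binary.Construct.Closure.ReflexiveTransitive using (Star)
open import Function.Definitions using (Injective)

-- Colours 1,2,3,4 are represented by 0F,1F,2F,3F.
Colour : Set
Colour = Fin 4

-- A 4-edge-coloured complete graph on vertex set Fin n: a colour for every
-- ordered pair, symmetric on distinct pairs (diagonal values are irrelevant).
record Colouring (n : ℕ) : Set where
  constructor mkCol
  field
    col : Fin n → Fin n → Colour
    sym : ∀ x y → x ≢ y → col x y ≡ col y x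
open Colouring public

σ : Colour → Colour
σ 0F = 1F
σ 1F = 2F
σ 2F = 3F
σ 3F = 0F

-- The elements of C₄ = ⟨σ⟩ are σ^k, k = 0,1,2,3.
σ^ : Fin 4 → Colour → Colour
σ^ 0F c = c
σ^ 1F c = σ c
σ^ 2F c = σ (σ c)
σ^ 3F c = σ (σ (σ c))

switchCol : ∀ {n} → (Fin n → Fin n → Colour) → Fin 4 → Fin n → Fin n → Fin n → Colour
switchCol c k v x y with x ≟ y
... | yes _ = c x y
... | no _ with x ≟ v | y ≟ v
...   | yes _ | _     = σ^ k (c x y)
...   | no _  | yes _ = σ^ k (c x y)
...   | no _  | no _  = c x y

data Switch {n : ℕ} (c c' : Colouring n) : Set where
  switch : (k : Fin 4) (v : Fin n) →
           (∀ x y → x ≢ y → col c' x y ≡ switchCol (col c) k v x y) →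
           Switch c c'

SwitchEquiv : ∀ {n} → Colouring n → Colouring n → Set
SwitchEquiv = Star Switch

HasMonoClique : ∀ {n} → Colouring n → ℕ → Colour → Set
HasMonoClique {n} c a i =
  Σ (Fin a → Fin n) λ f → Injective _≡_ _≡_ f ×
    (∀ p q → p ≢ q → col c (f p) (f q) ≡ i)

RC4Prop : (Colour → ℕ) → ℕ → Set
RC4Prop a n = (c : Colouring n) →
  ∃ λ (c' : Colouring n) → SwitchEquiv c c' × ∃ λ (i : Colour) → HasMonoClique c' (a i) i

RC4Is : (Colour → ℕ) → ℕ → Set
RC4Is a m = RC4Prop a m × (∀ n → n < m → ¬ RC4Prop a n)

a3434 : Colour → ℕ
a3434 0F = 3
a3434 1F = 4
a3434 2F = 3
a3434 3F = 4

-- Colours are read in ℤ/4, colour i having value i − 1, so that σ^ k adds k. Switching at v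
-- with σ^ k adds k to every edge at v; hence switch-equivalent colourings are exactly those
-- that differ by a potential k : V → ℤ/4, which adds k x + k y to the edge xy.
--
-- Upper bound: switching a colouring of K₇ so that every edge at vertex 0 gets colour j leaves
-- the same colouring L on the other six vertices, whatever j is. If L has an edge of colour 1
-- or 3, that edge and vertex 0 span a triangle of that colour. Otherwise L uses only colours 2
-- and 4, and R(3,3) = 6 gives a monochromatic triangle of L, which vertex 0 extends to a K₄.
--
-- Lower bound: switching leaves invariant twice the colour sum of a triangle and the
-- alternating colour sum around a 4-cycle. Colour K₆ with colour 4 on a pentagon and colour 2
-- everywhere else. Every triangle sum is then odd, which rules out triangles of colour 1 or 3,
-- and any 4 vertices carry a 4-cycle with non-zero alternating sum, which rules out every K₄.
module Submission where

open import Defs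
open import Relation.Binary.PropositionalEquality
  using (_≡_; _≢_; _≗_; refl; trans; cong; cong₂; subst; isEquivalence; module ≡-Reasoning)
  renaming (sym to ≡-sym)
open import Level using (0ℓ)
open import Algebra.Bundles using (CommutativeMonoid)
open import Algebra.Definitions {A = Colour} _≡_ using (Associative; Commutative; LeftIdentity)
open import Algebra.Structures {A = Colour} _≡_ using (IsCommutativeMonoid)
open import Algebra.Structures.Biased {A = Colour} _≡_ using (isCommutativeMonoidˡ)
open import Data.Nat using (ℕ; zero; suc; _≤_)
open import Data.Nat.Properties using (≤-pred)
open import Data.Fin using (Fin; zero; suc; _≟_; inject≤)
open import Data.Fin.Patterns using (0F; 1F; 2F; 3F; 4F)
open import Data.Fin.Properties using (all?; any?; suc-injective; inject≤-injective)
open import Data.Vec.Functional using (_∷_)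
open import Data.Product using (∃; _×_; _,_; proj₁)
open import Data.Sum using (_⊎_; inj₁; inj₂; swap; [_,_]′)
open import Data.Empty using (⊥-elim)
open import Function using (_∘_)
open import Function.Definitions using (Injective)
open import Relation.Nullary using (¬_; Dec; yes; no)
open import Relation.Nullary.Decidable using (from-yes; _⊎-dec_; _×-dec_; _→-dec_; ¬?)
open import Relation.Binary.Construct.Closure.ReflexiveTransitive using (ε; _◅_; _◅◅_)

-- ℤ/4 arithmetic on colours

infixl 6 _+_ _-_
infix 8 -_

_+_ : Colour → Colour → Colour
x + k = σ^ k x

-_ : Colour → Colour
- 0F = 0F
- 1F = 3F
- 2F = 2F
- 3F = 1F

_-_ : Colour → Colour → Colour
x - y = x + - y

double : Colour → Colour
double x = x + x

+-assoc : Associative _+_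
+-assoc = from-yes (all? λ x → all? λ y → all? λ z → (x + y) + z ≟ x + (y + z))

+-comm : Commutative _+_
+-comm = from-yes (all? λ x → all? λ y → x + y ≟ y + x)

+-identityˡ : LeftIdentity 0F _+_
+-identityˡ = from-yes (all? λ x → 0F + x ≟ x)

x+[y-x]≡y : ∀ x y → x + (y - x) ≡ y
x+[y-x]≡y = from-yes (all? λ x → all? λ y → x + (y - x) ≟ y)

[x+y]-y≡x : ∀ x y → (x + y) - y ≡ x
[x+y]-y≡x = from-yes (all? λ x → all? λ y → (x + y) - y ≟ x)

+-cancelʳ : ∀ s {x y} → x + s ≡ y + s → x ≡ y
+-cancelʳ s {x} {y} eq = begin
  x            ≡⟨ [x+y]-y≡x x s ⟨
  (x + s) - s  ≡⟨ cong (_- s) eq ⟩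
  (y + s) - s  ≡⟨ [x+y]-y≡x y s ⟩
  y            ∎
  where open ≡-Reasoning

double-double≡0F : ∀ x → double (double x) ≡ 0F
double-double≡0F = from-yes (all? λ x → double (double x) ≟ 0F)

+-isCommutativeMonoid : IsCommutativeMonoid _+_ 0F
+-isCommutativeMonoid = isCommutativeMonoidˡ record
  { isSemigroup = record
    { isMagma = record { isEquivalence = isEquivalence ; ∙-cong = cong₂ _+_ }
    ; assoc = +-assoc
    }
  ; identityˡ = +-identityˡ
  ; comm = +-comm
  }

+-commutativeMonoid : CommutativeMonoid 0ℓ 0ℓ
+-commutativeMonoid = record { isCommutativeMonoid = +-isCommutativeMonoid }

open import Algebra.Solver.CommutativeMonoid +-commutativeMonoid using (solve; _⊜_; _⊕_)
open import Algebra.Properties.CommutativeMonoid.Sum +-commutativeMonoid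
  using (sum-syntax; sum-cong-≗; sum-replicate-zero)

-- Switching adds a potential

Potential : ℕ → Set
Potential n = Fin n → Colour

record Shifted {n} (k : Potential n) (c c′ : Colouring n) : Set where
  constructor shifted
  field
    shift : ∀ x y → x ≢ y → col c′ x y ≡ col c x y + (k x + k y)
open Shifted public

shifted-trans : ∀ {n} {k l : Potential n} {c c′ c″} →
                Shifted k c c′ → Shifted l c′ c″ → Shifted (λ z → k z + l z) c c″
shifted-trans {k = k} {l} {c} {c′} {c″} sh sh′ = shifted λ x y x≢y → begin
  col c″ x y                                   ≡⟨ shift sh′ x y x≢y ⟩
  col c′ x y + (l x + l y)                     ≡⟨ cong (_+ (l x + l y)) (shift sh x y x≢y) ⟩
  col c x y + (k x + k y) + (l x + l y)        ≡⟨ regroup (col c x y) (k x) (k y) (l x) (l y) ⟩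
  col c x y + ((k x + l x) + (k y + l y))      ∎
  where
  open ≡-Reasoning
  regroup : ∀ a p q r s → a + (p + q) + (r + s) ≡ a + ((p + r) + (q + s))
  regroup = solve 5 (λ a p q r s → (a ⊕ (p ⊕ q)) ⊕ (r ⊕ s) ⊜ a ⊕ ((p ⊕ r) ⊕ (q ⊕ s))) refl

point : ∀ {n} → Fin n → Colour → Potential n
point v j z with z ≟ v
... | yes _ = j
... | no _  = 0F

point-suc : ∀ {n j} (v z : Fin n) → point (suc v) j (suc z) ≡ point v j z
point-suc v z with z ≟ v
... | yes _ = refl
... | no _  = refl

switchCol-point : ∀ {n} (c : Fin n → Fin n → Colour) j v x y → x ≢ y →
                  switchCol c j v x y ≡ c x y + (point v j x + point v j y)
switchCol-point c j v x y x≢y with x ≟ y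
... | yes x≡y = ⊥-elim (x≢y x≡y)
... | no _ with x ≟ v | y ≟ v
...   | yes x≡v | yes y≡v = ⊥-elim (x≢y (trans x≡v (≡-sym y≡v)))
...   | yes _   | no _    = refl
...   | no _    | yes _   = cong (c x y +_) (≡-sym (+-identityˡ j))
...   | no _    | no _    = refl

switch⇒shifted : ∀ {n} {c c′ : Colouring n} → Switch c c′ → ∃ λ k → Shifted k c c′
switch⇒shifted {c = c} (switch j v h) =
  point v j , shifted λ x y x≢y → trans (h x y x≢y) (switchCol-point (col c) j v x y x≢y)

switchEquiv⇒shifted : ∀ {n} {c c′ : Colouring n} → SwitchEquiv c c′ → ∃ λ k → Shifted k c c′
switchEquiv⇒shifted ε = (λ _ → 0F) , shifted λ _ _ _ → refl
switchEquiv⇒shifted (s ◅ rest) with switch⇒shifted s | switchEquiv⇒shifted rest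
... | k , sh | l , sh′ = (λ z → k z + l z) , shifted-trans sh sh′

Realizable : ∀ {n} → Potential n → Set
Realizable {n} k = (c : Colouring n) → ∃ λ c′ → SwitchEquiv c c′ × Shifted k c c′

switched : ∀ {n} → Colouring n → Colour → Fin n → Colouring n
switched c j v = mkCol (switchCol (col c) j v) λ x y x≢y → begin
  switchCol (col c) j v x y                ≡⟨ switchCol-point (col c) j v x y x≢y ⟩
  col c x y + (point v j x + point v j y)  ≡⟨ cong₂ _+_ (sym c x y x≢y) (+-comm (point v j x) (point v j y)) ⟩
  col c y x + (point v j y + point v j x)  ≡⟨ switchCol-point (col c) j v y x (x≢y ∘ ≡-sym) ⟨
  switchCol (col c) j v y x                ∎
  where open ≡-Reasoning

point-realizable : ∀ {n} (v : Fin n) j → Realizable (point v j)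
point-realizable v j c =
  switched c j v , switch j v (λ _ _ _ → refl) ◅ ε , shifted (switchCol-point (col c) j v)

0-realizable : ∀ {n} → Realizable {n} (λ _ → 0F)
0-realizable c = c , ε , shifted λ _ _ _ → refl

+-realizable : ∀ {n} {k l : Potential n} → Realizable k → Realizable l → Realizable (λ z → k z + l z)
+-realizable rk rl c with rk c
... | c′ , c~c′ , sh with rl c′
...   | c″ , c′~c″ , sh′ = c″ , c~c′ ◅◅ c′~c″ , shifted-trans sh sh′

∑-realizable : ∀ {m n} (g : Fin m → Potential n) → (∀ v → Realizable (g v)) →
               Realizable (λ z → ∑[ v < m ] g v z)
∑-realizable {zero}  g r = 0-realizable
∑-realizable {suc m} g r =
  +-realizable {k = g zero} {λ z → ∑[ v < m ] g (suc v) z} (r zero) (∑-realizable (g ∘ suc) (r ∘ suc))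

realizable-resp : ∀ {n} {k l : Potential n} → k ≗ l → Realizable k → Realizable l
realizable-resp {k = k} {l} k≗l rk c with rk c
... | c′ , c~c′ , sh = c′ , c~c′ , shifted λ x y x≢y →
  trans (shift sh x y x≢y) (cong (col c x y +_) (cong₂ _+_ (k≗l x) (k≗l y)))

∑-point : ∀ {n} (k : Potential n) → (λ z → ∑[ v < n ] point v (k v) z) ≗ k
∑-point {suc n} k zero    = cong (k zero +_) (sum-replicate-zero n)
∑-point {suc n} k (suc z) = begin
  0F + ∑[ v < n ] point (suc v) (k (suc v)) (suc z)  ≡⟨ +-identityˡ _ ⟩
  ∑[ v < n ] point (suc v) (k (suc v)) (suc z)       ≡⟨ sum-cong-≗ (λ v → point-suc v z) ⟩
  ∑[ v < n ] point v (k (suc v)) z                   ≡⟨ ∑-point (k ∘ suc) z ⟩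
  k (suc z)                                          ∎
  where open ≡-Reasoning

realizable : ∀ {n} (k : Potential n) → Realizable k
realizable k = realizable-resp (∑-point k) (∑-realizable _ λ v → point-realizable v (k v))

extend-clique : ∀ {n m i} {c : Colouring n} (K : HasMonoClique c m i) v →
                (∀ p → v ≢ proj₁ K p) → (∀ p → col c v (proj₁ K p) ≡ i) →
                HasMonoClique c (suc m) i
extend-clique {c = c} (f , f-inj , f-mono) v fresh edges = v ∷ f , inj , mono
  where
  inj : Injective _≡_ _≡_ (v ∷ f)
  inj {zero}  {zero}  _ = refl
  inj {zero}  {suc q} e = ⊥-elim (fresh q e)
  inj {suc p} {zero}  e = ⊥-elim (fresh p (≡-sym e))
  inj {suc p} {suc q} e = cong suc (f-inj e)
  mono : ∀ p q → p ≢ q → col c ((v ∷ f) p) ((v ∷ f) q) ≡ _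
  mono zero    zero    0≢0 = ⊥-elim (0≢0 refl)
  mono zero    (suc q) _   = edges q
  mono (suc p) zero    _   = trans (sym c (f p) v (fresh p ∘ ≡-sym)) (edges p)
  mono (suc p) (suc q) p≢q = f-mono p q (p≢q ∘ cong suc)

[]-clique : ∀ {n i} {c : Colouring n} → HasMonoClique c 0 i
[]-clique = (λ ()) , (λ { {()} }) , λ ()

edge-clique : ∀ {n i} {c : Colouring n} {x y} → x ≢ y → col c x y ≡ i → HasMonoClique c 2 i
edge-clique {c = c} {x} {y} x≢y xy =
  extend-clique {c = c} (extend-clique {c = c} ([]-clique {c = c}) y (λ ()) (λ ()))
    x (λ { zero → x≢y }) (λ { zero → xy })

triangle-clique : ∀ {n i} {c : Colouring n} {x y z} → x ≢ y → x ≢ z → y ≢ z →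
                  col c x y ≡ i → col c x z ≡ i → col c y z ≡ i → HasMonoClique c 3 i
triangle-clique {c = c} {x} {y} {z} x≢y x≢z y≢z xy xz yz =
  extend-clique {c = c} (edge-clique {c = c} y≢z yz)
    x (λ { 0F → x≢y ; 1F → x≢z }) (λ { 0F → xy ; 1F → xz })

clique-distinct : ∀ {n m i} {c : Colouring n} (K : HasMonoClique c m i) →
                  ∀ {p q} → p ≢ q → proj₁ K p ≢ proj₁ K q
clique-distinct (_ , f-inj , _) p≢q = p≢q ∘ f-inj

clique-map : ∀ {m n a i} {c : Colouring m} {d : Colouring n} (f : Fin m → Fin n) →
             Injective _≡_ _≡_ f → (∀ x y → x ≢ y → col d (f x) (f y) ≡ col c x y) →
             HasMonoClique c a i → HasMonoClique d a i
clique-map f f-inj agree (g , g-inj , g-mono) =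
  f ∘ g , g-inj ∘ f-inj , λ p q p≢q → trans (agree (g p) (g q) (p≢q ∘ g-inj)) (g-mono p q p≢q)

-- R(3,3) ≤ 6

record Three {n} (P : Fin n → Set) : Set where
  constructor three
  field
    p q r : Fin n
    p≢q : p ≢ q
    p≢r : p ≢ r
    q≢r : q ≢ r
    Pp : P p
    Pq : P q
    Pr : P r

pigeonhole : {P Q : Fin 5 → Set} → (∀ x → P x ⊎ Q x) → Three P ⊎ Three Q
pigeonhole P⊎Q = [ pigeonhole₀ P⊎Q , swap ∘ pigeonhole₀ (swap ∘ P⊎Q) ]′ (P⊎Q 0F)
  where
  pigeonhole₀ : {P Q : Fin 5 → Set} → (∀ x → P x ⊎ Q x) → P 0F → Three P ⊎ Three Q
  pigeonhole₀ P⊎Q P0 with P⊎Q 1F | P⊎Q 2F | P⊎Q 3F | P⊎Q 4F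
  ... | inj₁ P1 | inj₁ P2 | _       | _       = inj₁ (three 0F 1F 2F (λ ()) (λ ()) (λ ()) P0 P1 P2)
  ... | inj₁ P1 | inj₂ _  | inj₁ P3 | _       = inj₁ (three 0F 1F 3F (λ ()) (λ ()) (λ ()) P0 P1 P3)
  ... | inj₁ P1 | inj₂ _  | inj₂ _  | inj₁ P4 = inj₁ (three 0F 1F 4F (λ ()) (λ ()) (λ ()) P0 P1 P4)
  ... | inj₁ _  | inj₂ Q2 | inj₂ Q3 | inj₂ Q4 = inj₂ (three 2F 3F 4F (λ ()) (λ ()) (λ ()) Q2 Q3 Q4)
  ... | inj₂ _  | inj₁ P2 | inj₁ P3 | _       = inj₁ (three 0F 2F 3F (λ ()) (λ ()) (λ ()) P0 P2 P3)
  ... | inj₂ _  | inj₁ P2 | inj₂ _  | inj₁ P4 = inj₁ (three 0F 2F 4F (λ ()) (λ ()) (λ ()) P0 P2 P4)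
  ... | inj₂ Q1 | inj₁ _  | inj₂ Q3 | inj₂ Q4 = inj₂ (three 1F 3F 4F (λ ()) (λ ()) (λ ()) Q1 Q3 Q4)
  ... | inj₂ _  | inj₂ _  | inj₁ P3 | inj₁ P4 = inj₁ (three 0F 3F 4F (λ ()) (λ ()) (λ ()) P0 P3 P4)
  ... | inj₂ Q1 | inj₂ Q2 | inj₁ _  | inj₂ Q4 = inj₂ (three 1F 2F 4F (λ ()) (λ ()) (λ ()) Q1 Q2 Q4)
  ... | inj₂ Q1 | inj₂ Q2 | inj₂ Q3 | _       = inj₂ (three 1F 2F 3F (λ ()) (λ ()) (λ ()) Q1 Q2 Q3)

TwoColoured : ∀ {n} → Colouring n → Colour → Colour → Set
TwoColoured c a b = ∀ x y → x ≢ y → col c x y ≡ a ⊎ col c x y ≡ b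

fan-triangle : ∀ {n a b} (c : Colouring (suc n)) → TwoColoured c a b →
               Three (λ u → col c zero (suc u) ≡ a) → HasMonoClique c 3 a ⊎ HasMonoClique c 3 b
fan-triangle c two (three p q r p≢q p≢r q≢r ap aq ar)
  with two (suc p) (suc q) (p≢q ∘ suc-injective)
     | two (suc p) (suc r) (p≢r ∘ suc-injective)
     | two (suc q) (suc r) (q≢r ∘ suc-injective)
... | inj₁ pq | _       | _       = inj₁ (triangle-clique {c = c} (λ ()) (λ ()) (p≢q ∘ suc-injective) ap aq pq)
... | _       | inj₁ pr | _       = inj₁ (triangle-clique {c = c} (λ ()) (λ ()) (p≢r ∘ suc-injective) ap ar pr)
... | _       | _       | inj₁ qr = inj₁ (triangle-clique {c = c} (λ ()) (λ ()) (q≢r ∘ suc-injective) aq ar qr)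
... | inj₂ pq | inj₂ pr | inj₂ qr =
  inj₂ (triangle-clique {c = c} (p≢q ∘ suc-injective) (p≢r ∘ suc-injective) (q≢r ∘ suc-injective) pq pr qr)

ramsey33 : ∀ {a b} (c : Colouring 6) → TwoColoured c a b → HasMonoClique c 3 a ⊎ HasMonoClique c 3 b
ramsey33 c two with pigeonhole (λ u → two zero (suc u) (λ ()))
... | inj₁ T = fan-triangle c two T
... | inj₂ T = swap (fan-triangle c (λ x y x≢y → swap (two x y x≢y)) T)

-- The colouring left on the other vertices once every edge at vertex 0 has been switched to a
-- common colour; it does not depend on that colour.
link : ∀ {n} → Colouring (suc n) → Colouring n
link c = mkCol (λ u w → col c (suc u) (suc w) + (- col c zero (suc u) + - col c zero (suc w)))
  λ u w u≢w → cong₂ _+_ (sym c (suc u) (suc w) (u≢w ∘ suc-injective)) (+-comm (- col c zero (suc u)) _)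

apex-potential : ∀ {n} → Colouring (suc n) → Colour → Potential (suc n)
apex-potential c j zero    = j
apex-potential c j (suc u) = - col c zero (suc u)

link-clique⇒clique : ∀ {n m} (c : Colouring (suc n)) j → HasMonoClique (link c) m j →
                     ∃ λ c′ → SwitchEquiv c c′ × HasMonoClique c′ (suc m) j
link-clique⇒clique c j K = lift (realizable (apex-potential c j) c)
  where
  lift : (∃ λ c′ → SwitchEquiv c c′ × Shifted (apex-potential c j) c c′) →
         ∃ λ c′ → SwitchEquiv c c′ × HasMonoClique c′ (suc _) j
  lift (c′ , c~c′ , sh) = c′ , c~c′ , extend-clique {c = c′} K′ zero (λ _ ()) apex-edges
    where
    K′ : HasMonoClique c′ _ j
    K′ = clique-map {c = link c} {d = c′} suc suc-injective
           (λ u w u≢w → shift sh (suc u) (suc w) (u≢w ∘ suc-injective)) K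
    apex-edges : ∀ p → col c′ zero (suc (proj₁ K p)) ≡ j
    apex-edges p = trans (shift sh zero (suc (proj₁ K p)) (λ ())) (x+[y-x]≡y (col c zero (suc (proj₁ K p))) j)

Even : Colour → Set
Even x = x ≡ 0F ⊎ x ≡ 2F

¬even⇒odd : ∀ {x} → ¬ Even x → x ≡ 1F ⊎ x ≡ 3F
¬even⇒odd {0F} ¬even = ⊥-elim (¬even (inj₁ refl))
¬even⇒odd {1F} _     = inj₁ refl
¬even⇒odd {2F} ¬even = ⊥-elim (¬even (inj₂ refl))
¬even⇒odd {3F} _     = inj₂ refl

Even? : ∀ x → Dec (Even x)
Even? x = (x ≟ 0F) ⊎-dec (x ≟ 2F)

RamseyProp : (Colour → ℕ) → ℕ → Set
RamseyProp a n = (c : Colouring n) → ∃ λ i → HasMonoClique c (a i) i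

RamseyProp⇒RC4Prop : ∀ {a n} → RamseyProp a n → RC4Prop (suc ∘ a) (suc n)
RamseyProp⇒RC4Prop ramsey c =
  let (i , K) = ramsey (link c)
      (c′ , c~c′ , K′) = link-clique⇒clique c i K
  in c′ , c~c′ , i , K′

RC4Prop-resp : ∀ {a b n} → a ≗ b → RC4Prop a n → RC4Prop b n
RC4Prop-resp a≗b P c with P c
... | c′ , c~c′ , i , K = c′ , c~c′ , i , subst (λ m → HasMonoClique c′ m i) (a≗b i) K

a2323 : Colour → ℕ
a2323 0F = 2
a2323 1F = 3
a2323 2F = 2
a2323 3F = 3

1+a2323≗a3434 : suc ∘ a2323 ≗ a3434
1+a2323≗a3434 0F = refl
1+a2323≗a3434 1F = refl
1+a2323≗a3434 2F = refl
1+a2323≗a3434 3F = refl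

ramsey2323 : RamseyProp a2323 6
ramsey2323 c with any? (λ u → any? λ w → ¬? (u ≟ w) ×-dec Even? (col c u w))
... | yes (u , w , u≢w , inj₁ uw) = 0F , edge-clique {c = c} u≢w uw
... | yes (u , w , u≢w , inj₂ uw) = 2F , edge-clique {c = c} u≢w uw
... | no ¬even with ramsey33 c (λ u w u≢w → ¬even⇒odd λ e → ¬even (u , w , u≢w , e))
...   | inj₁ K = 1F , K
...   | inj₂ K = 3F , K

upper-bound : RC4Prop a3434 7
upper-bound = RC4Prop-resp 1+a2323≗a3434 (RamseyProp⇒RC4Prop ramsey2323)

-- Switching invariants and the lower bound

restrict : ∀ {m n} (f : Fin m → Fin n) → Injective _≡_ _≡_ f → Colouring n → Colouring m
restrict f f-inj c = mkCol (λ x y → col c (f x) (f y)) λ x y x≢y → sym c (f x) (f y) (x≢y ∘ f-inj)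

triangle : ∀ {n} → Colouring n → Fin n → Fin n → Fin n → Colour
triangle c x y z = col c x y + col c x z + col c y z

OddTriangles : ∀ {n} → Colouring n → Set
OddTriangles c = ∀ x y z → x ≢ y → x ≢ z → y ≢ z → double (triangle c x y z) ≡ 2F

Flat : ∀ {n} → Colouring n → Fin n → Fin n → Fin n → Fin n → Set
Flat c x y z w = col c x y + col c z w ≡ col c y z + col c w x

NoFlatQuadrangles : ∀ {n} → Colouring n → Set
NoFlatQuadrangles c = ∀ x y z w → x ≢ y → x ≢ z → x ≢ w → y ≢ z → y ≢ w → z ≢ w →
                      ¬ (Flat c x y z w × Flat c x z y w)

double-triangle-shift : ∀ {n} {k : Potential n} {c c′} → Shifted k c c′ →
                        ∀ {x y z} → x ≢ y → x ≢ z → y ≢ z →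
                        double (triangle c′ x y z) ≡ double (triangle c x y z)
double-triangle-shift {k = k} {c} {c′} sh {x} {y} {z} x≢y x≢z y≢z = begin
  double (triangle c′ x y z)
    ≡⟨ cong double (cong₂ _+_ (cong₂ _+_ (shift sh x y x≢y) (shift sh x z x≢z)) (shift sh y z y≢z)) ⟩
  double (col c x y + (k x + k y) + (col c x z + (k x + k z)) + (col c y z + (k y + k z)))
    ≡⟨ collect (col c x y) (col c x z) (col c y z) (k x) (k y) (k z) ⟩
  double (triangle c x y z) + double (double (k x + k y + k z))
    ≡⟨ cong (double (triangle c x y z) +_) (double-double≡0F (k x + k y + k z)) ⟩
  double (triangle c x y z)
    ∎
  where
  open ≡-Reasoning
  collect : ∀ a b d p q r → double (a + (p + q) + (b + (p + r)) + (d + (q + r))) ≡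
                            double (a + b + d) + double (double (p + q + r))
  collect = solve 6 (λ a b d p q r →
    (((a ⊕ (p ⊕ q)) ⊕ (b ⊕ (p ⊕ r))) ⊕ (d ⊕ (q ⊕ r)))
      ⊕ (((a ⊕ (p ⊕ q)) ⊕ (b ⊕ (p ⊕ r))) ⊕ (d ⊕ (q ⊕ r)))
    ⊜ (((a ⊕ b) ⊕ d) ⊕ ((a ⊕ b) ⊕ d)) ⊕
      ((((p ⊕ q) ⊕ r) ⊕ ((p ⊕ q) ⊕ r)) ⊕ (((p ⊕ q) ⊕ r) ⊕ ((p ⊕ q) ⊕ r)))) refl

flat-shift : ∀ {n} {k : Potential n} {c c′} → Shifted k c c′ →
             ∀ {x y z w} → x ≢ y → y ≢ z → z ≢ w → w ≢ x → Flat c′ x y z w → Flat c x y z w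
flat-shift {k = k} {c} {c′} sh {x} {y} {z} {w} x≢y y≢z z≢w w≢x flat′ = +-cancelʳ s (begin
  col c x y + col c z w + s                          ≡⟨ regroup (col c x y) (col c z w) (k x) (k y) (k z) (k w) ⟩
  col c x y + (k x + k y) + (col c z w + (k z + k w)) ≡⟨ cong₂ _+_ (shift sh x y x≢y) (shift sh z w z≢w) ⟨
  col c′ x y + col c′ z w                            ≡⟨ flat′ ⟩
  col c′ y z + col c′ w x                            ≡⟨ cong₂ _+_ (shift sh y z y≢z) (shift sh w x w≢x) ⟩
  col c y z + (k y + k z) + (col c w x + (k w + k x)) ≡⟨ regroup′ (col c y z) (col c w x) (k x) (k y) (k z) (k w) ⟩
  col c y z + col c w x + s                          ∎)
  where
  open ≡-Reasoning
  s = k x + k y + (k z + k w)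
  regroup : ∀ a b p q r t → a + b + (p + q + (r + t)) ≡ a + (p + q) + (b + (r + t))
  regroup = solve 6 (λ a b p q r t →
    (a ⊕ b) ⊕ ((p ⊕ q) ⊕ (r ⊕ t)) ⊜ (a ⊕ (p ⊕ q)) ⊕ (b ⊕ (r ⊕ t))) refl
  regroup′ : ∀ a b p q r t → a + (q + r) + (b + (t + p)) ≡ a + b + (p + q + (r + t))
  regroup′ = solve 6 (λ a b p q r t →
    (a ⊕ (q ⊕ r)) ⊕ (b ⊕ (t ⊕ p)) ⊜ (a ⊕ b) ⊕ ((p ⊕ q) ⊕ (r ⊕ t))) refl

oddTriangles-shift : ∀ {n} {k : Potential n} {c c′} → Shifted k c c′ → OddTriangles c → OddTriangles c′
oddTriangles-shift sh odd x y z x≢y x≢z y≢z =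
  trans (double-triangle-shift sh x≢y x≢z y≢z) (odd x y z x≢y x≢z y≢z)

noFlat-shift : ∀ {n} {k : Potential n} {c c′} → Shifted k c c′ → NoFlatQuadrangles c → NoFlatQuadrangles c′
noFlat-shift sh noFlat x y z w x≢y x≢z x≢w y≢z y≢w z≢w (flat₁ , flat₂) =
  noFlat x y z w x≢y x≢z x≢w y≢z y≢w z≢w
    ( flat-shift sh x≢y y≢z z≢w (x≢w ∘ ≡-sym) flat₁
    , flat-shift sh x≢z (y≢z ∘ ≡-sym) y≢w (x≢w ∘ ≡-sym) flat₂ )

module _ {m n} {f : Fin m → Fin n} (f-inj : Injective _≡_ _≡_ f) {c : Colouring n} where
  private
    f-≢ : ∀ {x y} → x ≢ y → f x ≢ f y
    f-≢ p≢q = p≢q ∘ f-inj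

  oddTriangles-restrict : OddTriangles c → OddTriangles (restrict f f-inj c)
  oddTriangles-restrict odd x y z x≢y x≢z y≢z = odd (f x) (f y) (f z) (f-≢ x≢y) (f-≢ x≢z) (f-≢ y≢z)

  noFlat-restrict : NoFlatQuadrangles c → NoFlatQuadrangles (restrict f f-inj c)
  noFlat-restrict noFlat x y z w x≢y x≢z x≢w y≢z y≢w z≢w =
    noFlat (f x) (f y) (f z) (f w) (f-≢ x≢y) (f-≢ x≢z) (f-≢ x≢w) (f-≢ y≢z) (f-≢ y≢w) (f-≢ z≢w)

mono-triangle : ∀ {n i} {c : Colouring n} → OddTriangles c → HasMonoClique c 3 i → double (i + i + i) ≡ 2F
mono-triangle {c = c} odd K@(f , _ , mono) =
  trans (cong double (≡-sym (cong₂ _+_ (cong₂ _+_ (mono 0F 1F (λ ())) (mono 0F 2F (λ ()))) (mono 1F 2F (λ ())))))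
        (odd (f 0F) (f 1F) (f 2F) (distinct (λ ())) (distinct (λ ())) (distinct (λ ())))
  where distinct = clique-distinct {c = c} K

noFlat⇒noK4 : ∀ {n i} {c : Colouring n} → NoFlatQuadrangles c → ¬ HasMonoClique c 4 i
noFlat⇒noK4 {c = c} noFlat K@(f , _ , mono) = noFlat (f 0F) (f 1F) (f 2F) (f 3F)
  (distinct (λ ())) (distinct (λ ())) (distinct (λ ())) (distinct (λ ())) (distinct (λ ())) (distinct (λ ()))
  (flat 0F 1F 2F 3F (λ ()) (λ ()) (λ ()) (λ ()) , flat 0F 2F 1F 3F (λ ()) (λ ()) (λ ()) (λ ()))
  where
  distinct = clique-distinct {c = c} K
  flat : ∀ p q r s → p ≢ q → r ≢ s → q ≢ r → s ≢ p → Flat c (f p) (f q) (f r) (f s)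
  flat p q r s p≢q r≢s q≢r s≢p =
    trans (cong₂ _+_ (mono p q p≢q) (mono r s r≢s)) (≡-sym (cong₂ _+_ (mono q r q≢r) (mono s p s≢p)))

no-clique : ∀ {n} {c : Colouring n} → OddTriangles c → NoFlatQuadrangles c →
            ∀ i → ¬ HasMonoClique c (a3434 i) i
no-clique {c = c} odd _ 0F K with mono-triangle {c = c} odd K
... | ()
no-clique {c = c} odd _ 2F K with mono-triangle {c = c} odd K
... | ()
no-clique {c = c} _ noFlat 1F K = noFlat⇒noK4 {c = c} noFlat K
no-clique {c = c} _ noFlat 3F K = noFlat⇒noK4 {c = c} noFlat K

pentagon : Fin 5 → Fin 5 → Colour
pentagon 0F 1F = 3F
pentagon 1F 2F = 3F
pentagon 2F 3F = 3F
pentagon 3F 4F = 3F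
pentagon 4F 0F = 3F
pentagon 1F 0F = 3F
pentagon 2F 1F = 3F
pentagon 3F 2F = 3F
pentagon 4F 3F = 3F
pentagon 0F 4F = 3F
pentagon _  _  = 1F

c₀-col : Fin 6 → Fin 6 → Colour
c₀-col (suc x) (suc y) = pentagon x y
c₀-col _       _       = 1F

c₀ : Colouring 6
c₀ = mkCol c₀-col λ x y _ → from-yes (all? λ x → all? λ y → c₀-col x y ≟ c₀-col y x) x y

c₀-oddTriangles : OddTriangles c₀
c₀-oddTriangles x y z _ _ _ =
  from-yes (all? λ x → all? λ y → all? λ z → double (triangle c₀ x y z) ≟ 2F) x y z

c₀-noFlat : NoFlatQuadrangles c₀
c₀-noFlat = from-yes (all? λ x → all? λ y → all? λ z → all? λ w →
  ¬? (x ≟ y) →-dec ¬? (x ≟ z) →-dec ¬? (x ≟ w) →-dec ¬? (y ≟ z) →-dec ¬? (y ≟ w) →-dec ¬? (z ≟ w) →-dec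
  ¬? ((col c₀ x y + col c₀ z w ≟ col c₀ y z + col c₀ w x) ×-dec
      (col c₀ x z + col c₀ y w ≟ col c₀ z y + col c₀ w x)))

c₀-switchClass-cliqueFree : ∀ {n} {f : Fin n → Fin 6} (f-inj : Injective _≡_ _≡_ f) {c′} →
                            SwitchEquiv (restrict f f-inj c₀) c′ → ∀ i → ¬ HasMonoClique c′ (a3434 i) i
c₀-switchClass-cliqueFree f-inj {c′} c~c′ with switchEquiv⇒shifted c~c′
... | k , sh = no-clique {c = c′} (oddTriangles-shift sh (oddTriangles-restrict f-inj {c₀} c₀-oddTriangles))
                                  (noFlat-shift sh (noFlat-restrict f-inj {c₀} c₀-noFlat))

lower-bound : ∀ {n} → n ≤ 6 → ¬ RC4Prop a3434 n
lower-bound n≤6 P with P (restrict (λ x → inject≤ x n≤6) (inject≤-injective n≤6 n≤6 _ _) c₀)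
... | c′ , c~c′ , i , K = c₀-switchClass-cliqueFree (inject≤-injective n≤6 n≤6 _ _) c~c′ i K

theorem24 : RC4Is a3434 7
theorem24 = upper-bound , λ n n<7 → lower-bound (≤-pred n<7)
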